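{- Let ${\cal G}$ be a set of subsets of ${\cal A}$ and suppose $(G,{\cal H})\in{\cal R}({\cal G})$. Then: (a) $G-\bigcup{\cal H}$ is an atom over ${\cal G}$, and in fact $G-\bigcup{\cal H}=\bigcap({\cal G}-{\cal H})\cap\bigcap_{H\in{\cal H}}\overline{H}$; (b) if $(G',{\cal H})\in{\cal R}({\cal G})$, then $G-\bigcup{\cal H}=G'-\bigcup{\cal H}$; (c) if $(G',{\cal H}')\in{\cal R}({\cal G})$ and ${\cal H}\neq{\cal H}'$, then $(G-\bigcup{\cal H})\cap(G'-\bigcup{\cal H}')=\emptyset$.
   Context: $\overline{H}$ denotes ${\cal A}-H$. For $G\in{\cal G}$, a set ${\cal H}\subseteq{\cal G}$ is a $G$-maximal subset of ${\cal G}$ if $G-\bigcup{\cal H}\neq\emptyset$ and $G-((\bigcup{\cal H})\cup G')=\emptyset$ for all $G'\in{\cal G}-{\cal H}$. ${\cal R}({\cal G})=\{(G,{\cal H}):G\in{\cal G},\ {\cal H}\text{ is a }G\text{ -maximal subset of }{\cal G}\}$. An atom over ${\cal G}$ is a nonempty set of the form $\bigcap_{G''\in{\cal G}}G''^{*}$ where each $G''^{*}$ is either $G''$ or $\overline{G''}$. -}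

module Defs where

open import Level using (0ℓ)
open import Data.Bool using (Bool; true; false; if_then_else_; _∧_; not; T)
open import Data.Product using (Σ; ∃; _×_; _,_)
open import Relation.Nullary using (¬_)
open import Relation.Unary using (Pred; _∖_; _∪_; _∩_; _≐_; Empty; Satisfiable)

-- A subset of the universe 𝒜 (= the type A), as a characteristic function
-- (membership is classical/decidable, as in the paper).
BSet : Set → Set
BSet A = A → Bool

Fam : Set → Set
Fam A = BSet A → Bool

⟦_⟧ : {A : Set} → BSet A → Pred A 0ℓ
⟦ S ⟧ x = T (S x)

_∈ᶠ_ : {A : Set} → BSet A → Fam A → Set
S ∈ᶠ 𝒦 = T (𝒦 S)

_⊆ᶠ_ : {A : Set} → Fam A → Fam A → Set
ℋ ⊆ᶠ 𝒢 = ∀ S → S ∈ᶠ ℋ → S ∈ᶠ 𝒢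

_-ᶠ_ : {A : Set} → Fam A → Fam A → Fam A
(𝒢 -ᶠ ℋ) S = 𝒢 S ∧ not (ℋ S)

⋃ : {A : Set} → Fam A → Pred A 0ℓ
⋃ ℋ x = ∃ λ H → H ∈ᶠ ℋ × T (H x)

⋂ : {A : Set} → Fam A → Pred A 0ℓ
⋂ 𝒦 x = ∀ H → H ∈ᶠ 𝒦 → T (H x)

⋂̄ : {A : Set} → Fam A → Pred A 0ℓ
⋂̄ ℋ x = ∀ H → H ∈ᶠ ℋ → ¬ T (H x)

IsMaximal : {A : Set} → Fam A → BSet A → Fam A → Set
IsMaximal 𝒢 G ℋ =
  (ℋ ⊆ᶠ 𝒢)
  × Satisfiable (⟦ G ⟧ ∖ ⋃ ℋ)
  × (∀ G′ → G′ ∈ᶠ (𝒢 -ᶠ ℋ) → Empty (⟦ G ⟧ ∖ (⋃ ℋ ∪ ⟦ G′ ⟧)))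

InR : {A : Set} → Fam A → BSet A → Fam A → Set
InR 𝒢 G ℋ = G ∈ᶠ 𝒢 × IsMaximal 𝒢 G ℋ

-- X is an atom over 𝒢: nonempty, and X = ⋂_{G'' ∈ 𝒢} G''*, where the choice
-- function c picks G''* = G'' (c G'' = true) or G''* = complement of G'' (c G'' = false).
IsAtom : {A : Set} → Fam A → Pred A 0ℓ → Set
IsAtom {A} 𝒢 X =
  Satisfiable X
  × Σ (BSet A → Bool) λ c →
      X ≐ (λ x → ∀ G″ → G″ ∈ᶠ 𝒢 → (if c G″ then T (G″ x) else ¬ T (G″ x)))

module Submission where

open import Defs
open import Level using (0ℓ)
open import Data.Bool using (Bool; true; false; T; T?; not; _∧_; if_then_else_)
open import Data.Empty using (⊥-elim)
open import Data.Product using (_×_; _,_; proj₁)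
open import Data.Sum using ([_,_])
open import Relation.Binary.PropositionalEquality using (_≡_; refl; trans; sym)
open import Relation.Nullary using (¬_)
open import Relation.Nullary.Decidable using (decidable-stable)
open import Relation.Unary using (Pred; _⊆_; _∖_; _∩_; _≐_; Empty)
open import Relation.Unary.Properties using (≐-sym; ≐-trans)

-- Every point of G − ⋃ℋ lies outside each member of ℋ and, by maximality,
-- inside each member of 𝒢 − ℋ; conversely G itself is in 𝒢 − ℋ, so these
-- conditions force membership in G − ⋃ℋ.  The conditions fix, for every
-- member of 𝒢, whether the point is in it, which makes G − ⋃ℋ an atom and
-- lets a point of it recover ℋ as the members of 𝒢 that miss it.

≡true⇒T : ∀ {b} → b ≡ true → T b
≡true⇒T refl = _

≡false⇒¬T : ∀ {b} → b ≡ false → ¬ T b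
≡false⇒¬T refl ()

T-∧-not⁺ : ∀ b c → T b → ¬ T c → T (b ∧ not c)
T-∧-not⁺ true false _ _  = _
T-∧-not⁺ true true  _ ¬c = ⊥-elim (¬c _)

T-∧-not⁻ : ∀ b c → T (b ∧ not c) → T b × ¬ T c
T-∧-not⁻ true false _ = _ , λ ()

module _ {A : Set} where

  cell : Fam A → Fam A → Pred A 0ℓ
  cell 𝒢 ℋ = ⋂ (𝒢 -ᶠ ℋ) ∩ ⋂̄ ℋ

  atom : Fam A → (BSet A → Bool) → Pred A 0ℓ
  atom 𝒢 c x = ∀ G″ → G″ ∈ᶠ 𝒢 → (if c G″ then T (G″ x) else ¬ T (G″ x))

  ¬⋃⇒⋂̄ : (ℋ : Fam A) {x : A} → ¬ ⋃ ℋ x → ⋂̄ ℋ x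
  ¬⋃⇒⋂̄ ℋ x∉⋃ H H∈ℋ x∈H = x∉⋃ (H , H∈ℋ , x∈H)

  cell≐atom : (𝒢 ℋ : Fam A) → ℋ ⊆ᶠ 𝒢 → cell 𝒢 ℋ ≐ atom 𝒢 (λ S → not (ℋ S))
  cell≐atom 𝒢 ℋ ℋ⊆𝒢 = to , from
    where
    to : cell 𝒢 ℋ ⊆ atom 𝒢 (λ S → not (ℋ S))
    to (in-rest , out-ℋ) S S∈𝒢 with ℋ S in eq
    ... | true  = out-ℋ S (≡true⇒T eq)
    ... | false = in-rest S (T-∧-not⁺ (𝒢 S) (ℋ S) S∈𝒢 (≡false⇒¬T eq))

    from : atom 𝒢 (λ S → not (ℋ S)) ⊆ cell 𝒢 ℋ
    from {x} at = in-rest , out-ℋ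
      where
      in-rest : ⋂ (𝒢 -ᶠ ℋ) x
      in-rest S S∈𝒢-ℋ with T-∧-not⁻ (𝒢 S) (ℋ S) S∈𝒢-ℋ
      ... | S∈𝒢 , S∉ℋ with ℋ S | at S S∈𝒢
      ...   | true  | _   = ⊥-elim (S∉ℋ _)
      ...   | false | x∈S = x∈S

      out-ℋ : ⋂̄ ℋ x
      out-ℋ S S∈ℋ with ℋ S | S∈ℋ | at S (ℋ⊆𝒢 S S∈ℋ)
      ... | true  | _ | x∉S = x∉S

  cell⇒≡missing : (𝒢 ℋ : Fam A) → ℋ ⊆ᶠ 𝒢 → ∀ {x} → cell 𝒢 ℋ x →
                    ∀ S → ℋ S ≡ 𝒢 S ∧ not (S x)
  cell⇒≡missing 𝒢 ℋ ℋ⊆𝒢 {x} (in-rest , out-ℋ) S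
    with ℋ S in eqℋ | 𝒢 S in eq𝒢 | S x in eqS
  ... | true  | true  | true  = ⊥-elim (out-ℋ S (≡true⇒T eqℋ) (≡true⇒T eqS))
  ... | true  | true  | false = refl
  ... | true  | false | _     = ⊥-elim (≡false⇒¬T eq𝒢 (ℋ⊆𝒢 S (≡true⇒T eqℋ)))
  ... | false | false | _     = refl
  ... | false | true  | true  = refl
  ... | false | true  | false =
    ⊥-elim (≡false⇒¬T eqS (in-rest S (T-∧-not⁺ (𝒢 S) (ℋ S) (≡true⇒T eq𝒢) (≡false⇒¬T eqℋ))))

  cells-overlap⇒≡ : (𝒢 ℋ ℋ′ : Fam A) → ℋ ⊆ᶠ 𝒢 → ℋ′ ⊆ᶠ 𝒢 → ∀ {x} →
                    cell 𝒢 ℋ x → cell 𝒢 ℋ′ x → ∀ S → ℋ S ≡ ℋ′ S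
  cells-overlap⇒≡ 𝒢 ℋ ℋ′ ℋ⊆𝒢 ℋ′⊆𝒢 x∈cell x∈cell′ S =
    trans (cell⇒≡missing 𝒢 ℋ ℋ⊆𝒢 x∈cell S) (sym (cell⇒≡missing 𝒢 ℋ′ ℋ′⊆𝒢 x∈cell′ S))

  cell⊆∖⋃ : (𝒢 : Fam A) (G : BSet A) (ℋ : Fam A) → G ∈ᶠ 𝒢 → ¬ G ∈ᶠ ℋ →
            cell 𝒢 ℋ ⊆ ⟦ G ⟧ ∖ ⋃ ℋ
  cell⊆∖⋃ 𝒢 G ℋ G∈𝒢 G∉ℋ (in-rest , out-ℋ) =
    in-rest G (T-∧-not⁺ (𝒢 G) (ℋ G) G∈𝒢 G∉ℋ) , λ (H , H∈ℋ , x∈H) → out-ℋ H H∈ℋ x∈H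

  module _ {𝒢 : Fam A} {G : BSet A} {ℋ : Fam A} where

    maximal⇒∉ : IsMaximal 𝒢 G ℋ → ¬ G ∈ᶠ ℋ
    maximal⇒∉ (_ , (y , y∈G , y∉⋃) , _) G∈ℋ = y∉⋃ (G , G∈ℋ , y∈G)

    maximal⇒∖⋃⊆cell : IsMaximal 𝒢 G ℋ → ⟦ G ⟧ ∖ ⋃ ℋ ⊆ cell 𝒢 ℋ
    maximal⇒∖⋃⊆cell (_ , _ , covered) {x} (x∈G , x∉⋃) = in-rest , ¬⋃⇒⋂̄ ℋ x∉⋃
      where
      in-rest : ⋂ (𝒢 -ᶠ ℋ) x
      in-rest S S∈𝒢-ℋ =
        decidable-stable (T? (S x)) λ x∉S → covered S S∈𝒢-ℋ x (x∈G , [ x∉⋃ , x∉S ])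

    InR⇒∖⋃≐cell : InR 𝒢 G ℋ → ⟦ G ⟧ ∖ ⋃ ℋ ≐ cell 𝒢 ℋ
    InR⇒∖⋃≐cell (G∈𝒢 , maximal) =
      maximal⇒∖⋃⊆cell maximal , cell⊆∖⋃ 𝒢 G ℋ G∈𝒢 (maximal⇒∉ maximal)

lemma4p3 : {A : Set} (𝒢 : Fam A) (G : BSet A) (ℋ : Fam A) → InR 𝒢 G ℋ →
    (IsAtom 𝒢 (⟦ G ⟧ ∖ ⋃ ℋ) × ((⟦ G ⟧ ∖ ⋃ ℋ) ≐ (⋂ (𝒢 -ᶠ ℋ) ∩ ⋂̄ ℋ)))
    × (∀ (G′ : BSet A) → InR 𝒢 G′ ℋ → (⟦ G ⟧ ∖ ⋃ ℋ) ≐ (⟦ G′ ⟧ ∖ ⋃ ℋ))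
    × (∀ (G′ : BSet A) (ℋ′ : Fam A) → InR 𝒢 G′ ℋ′ → ¬ (∀ S → ℋ S ≡ ℋ′ S)
        → Empty ((⟦ G ⟧ ∖ ⋃ ℋ) ∩ (⟦ G′ ⟧ ∖ ⋃ ℋ′)))
lemma4p3 𝒢 G ℋ r@(_ , ℋ⊆𝒢 , nonempty , _) =
    ((nonempty , (λ S → not (ℋ S)) , ≐-trans diff≐cell (cell≐atom 𝒢 ℋ ℋ⊆𝒢)) , diff≐cell)
  , (λ G′ r′ → ≐-trans diff≐cell (≐-sym (InR⇒∖⋃≐cell r′)))
  , λ G′ ℋ′ r′@(_ , ℋ′⊆𝒢 , _) ℋ≢ℋ′ x (x∈D , x∈D′) →
      ℋ≢ℋ′ (cells-overlap⇒≡ 𝒢 ℋ ℋ′ ℋ⊆𝒢 ℋ′⊆𝒢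
              (proj₁ diff≐cell x∈D) (proj₁ (InR⇒∖⋃≐cell r′) x∈D′))
  where
  diff≐cell : ⟦ G ⟧ ∖ ⋃ ℋ ≐ cell 𝒢 ℋ
  diff≐cell = InR⇒∖⋃≐cell r
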